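{- Let $p$ be a prime, $s\geq1$, $E_s=\{1\leq i\leq s+\lceil\frac{s}{p-1}-1\rceil:\ \gcd(i,p)=1\}$, and let $(c_i)_{i\geq 1}$ be the increasing enumeration of $F_s=\bigcup_{b\in E_s}\{p^jb:\ j\geq 0\}$. Then $c_i=i$ for all $1\leq i\leq s+\lceil\frac{s}{p-1}-1\rceil$, and $c_i=pc_{i-s}$ for all $i\geq s+\lceil\frac{s}{p-1}\rceil$. -}

module Defs where

open import Data.Nat using (ℕ; zero; suc; _+_; _*_; _∸_; _^_; _≤_; _<_)
open import Data.Nat.DivMod using (_/_)
open import Data.Nat.Coprimality using (Coprime)
open import Data.Product using (Σ; ∃; _×_)
open import Relation.Binary.PropositionalEquality using (_≡_)

-- Ceiling division ⌈ a / b ⌉ for b ≥ 1 (junk value 0 when b = 0; never used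
-- at b = 0 below since p is prime, so p ∸ 1 ≥ 1).
⌈_/_⌉ : ℕ → ℕ → ℕ
⌈ a / zero ⌉ = 0
⌈ a / suc k ⌉ = (a + k) / suc k

-- The bound  s + ⌈ s/(p-1) - 1 ⌉ .  Since s ≥ 1, s/(p-1) > 0, so
-- ⌈ s/(p-1) - 1 ⌉ = ⌈ s/(p-1) ⌉ - 1 ≥ 0.
bound : ℕ → ℕ → ℕ
bound p s = s + ⌈ s / (p ∸ 1) ⌉ ∸ 1

E : ℕ → ℕ → ℕ → Set
E p s i = 1 ≤ i × i ≤ bound p s × Coprime i p

F : ℕ → ℕ → ℕ → Set
F p s n = Σ ℕ λ b → Σ ℕ λ j → E p s b × n ≡ p ^ j * b

-- c (indexed from 1; c 0 is ignored) is the increasing enumeration of the set P.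
IsIncreasingEnumeration : (ℕ → Set) → (ℕ → ℕ) → Set
IsIncreasingEnumeration P c =
  (∀ i j → 1 ≤ i → i < j → c i < c j) ×
  (∀ i → 1 ≤ i → P (c i)) ×
  (∀ n → P n → Σ ℕ λ i → 1 ≤ i × c i ≡ n)

{-# OPTIONS --safe #-}
module Submission where

-- Every n ≤ B = s + ⌈s/(p−1)⌉ − 1 is p^j b with b ≤ n prime to p, so F contains [1, B] and
-- c fixes it. Write B = u + s with u = ⌈s/(p−1)⌉ − 1 = ⌊B/p⌋: an element p^j b of F above B
-- has j ≥ 1, so the elements of F above B are exactly the p m with m ∈ F and m > u. Thus
-- c(B+1), c(B+2), … and p c(u+1), p c(u+2), … enumerate the same set increasingly, and
-- therefore coincide, which is c i = p c(i − s) for i > B.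

open import Defs
open import Data.Nat
  using ( ℕ; zero; suc; _+_; _*_; _∸_; _^_; _≤_; _<_; z≤n; s≤s; s≤s⁻¹; _≤?_
        ; NonZero; nonTrivial⇒n>1)
open import Data.Nat.Properties
open import Data.Nat.Divisibility using (_∣_; _∣?_; divides)
open import Data.Nat.DivMod using (_/_; _%_; m≡m%n+[m/n]*n; m%n<n; m/n*n≤m)
open import Data.Nat.Coprimality using (Coprime)
open import Data.Nat.Primality
  using (Prime; prime⇒irreducible; prime⇒nonTrivial; prime⇒nonZero)
open import Data.Nat.Induction using (<-rec)
open import Data.Nat.Tactic.RingSolver using (solve-∀)
open import Data.Product using (Σ; ∃; ∃₂; _×_; _,_)
open import Data.Sum using (inj₁; inj₂)
open import Function using (_∘_)
open import Level using (0ℓ)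
open import Relation.Binary.Core using (_Preserves_⟶_)
open import Relation.Binary.PropositionalEquality
  using (_≡_; refl; sym; trans; cong; subst; module ≡-Reasoning)
open import Relation.Nullary using (¬_; yes; no; contradiction)
open import Relation.Unary using (Pred; _⊆_; _≐_; _∩_)

image : (ℕ → ℕ) → Pred ℕ 0ℓ → Pred ℕ 0ℓ
image h P n = ∃ λ m → P m × n ≡ h m

private variable
  P Q : Pred ℕ 0ℓ
  c d : ℕ → ℕ

enum-mono : IsIncreasingEnumeration P c → ∀ {i j} → 1 ≤ i → i ≤ j → c i ≤ c j
enum-mono (increasing , _) {i} {j} 1≤i i≤j with m≤n⇒m<n∨m≡n i≤j
... | inj₁ i<j  = <⇒≤ (increasing i j 1≤i i<j)
... | inj₂ refl = ≤-refl

index≤enum : IsIncreasingEnumeration P c → P ⊆ (1 ≤_) → ∀ {i} → 1 ≤ i → i ≤ c i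
index≤enum (_ , member , _) positive {suc zero} _ = positive (member 1 ≤-refl)
index≤enum enum@(increasing , _) positive {suc (suc i)} _ =
  ≤-trans (s≤s (index≤enum enum positive (s≤s z≤n)))
          (increasing (suc i) (suc (suc i)) (s≤s z≤n) ≤-refl)

enum-fixes-next : IsIncreasingEnumeration P c → P ⊆ (1 ≤_) → ∀ {N} → P (suc N) →
  (∀ {i} → 1 ≤ i → i ≤ N → c i ≡ i) → c (suc N) ≡ suc N
enum-fixes-next {c = c} enum@(_ , _ , surjective) positive {N} P[1+N] fixed
  with surjective (suc N) P[1+N]
... | k , 1≤k , ck≡1+N with k ≤? N
...   | yes k≤N = contradiction (trans (sym (fixed 1≤k k≤N)) ck≡1+N) (<⇒≢ (s≤s k≤N))
...   | no k≰N  = ≤-antisym (subst (c (suc N) ≤_) ck≡1+N (enum-mono enum (s≤s z≤n) (≰⇒> k≰N)))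
                            (index≤enum enum positive (s≤s z≤n))

enum-fixes-prefix : IsIncreasingEnumeration P c → P ⊆ (1 ≤_) → ∀ N →
  (∀ {n} → 1 ≤ n → n ≤ N → P n) → ∀ {i} → 1 ≤ i → i ≤ N → c i ≡ i
enum-fixes-prefix enum positive zero prefix 1≤i i≤0 = contradiction (≤-trans 1≤i i≤0) λ ()
enum-fixes-prefix enum positive (suc N) prefix 1≤i i≤1+N with m≤n⇒m<n∨m≡n i≤1+N
... | inj₁ (s≤s i≤N) =
  enum-fixes-prefix enum positive N (λ 1≤n → prefix 1≤n ∘ m≤n⇒m≤1+n) 1≤i i≤N
... | inj₂ refl = enum-fixes-next enum positive (prefix 1≤i ≤-refl)
  (enum-fixes-prefix enum positive N (λ 1≤n → prefix 1≤n ∘ m≤n⇒m≤1+n))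

enum-drop : IsIncreasingEnumeration P c → P ⊆ (1 ≤_) →
  ∀ N → (∀ {i} → 1 ≤ i → i ≤ N → c i ≡ i) →
  IsIncreasingEnumeration (P ∩ (N <_)) (λ j → c (N + j))
enum-drop {P} {c} enum@(increasing , member , surjective) positive N fixed =
  (λ i j 1≤i i<j → increasing (N + i) (N + j) (shifted 1≤i) (+-monoʳ-< N i<j)) ,
  (λ j 1≤j → member (N + j) (shifted 1≤j) ,
             <-≤-trans (m<m+n N 1≤j) (index≤enum enum positive (shifted 1≤j))) ,
  surjective-above
  where
  shifted : ∀ {j} → 1 ≤ j → 1 ≤ N + j
  shifted {j} 1≤j = ≤-trans 1≤j (m≤n+m j N)

  surjective-above : ∀ n → (P ∩ (N <_)) n → Σ ℕ λ j → 1 ≤ j × c (N + j) ≡ n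
  surjective-above n (Pn , N<n) with surjective n Pn
  ... | i , 1≤i , ci≡n with i ≤? N
  ...   | yes i≤N = contradiction (trans (sym (fixed 1≤i i≤N)) ci≡n) (<⇒≢ (≤-<-trans i≤N N<n))
  ...   | no i≰N  =
    i ∸ N , m<n⇒0<n∸m (≰⇒> i≰N) , trans (cong c (m+[n∸m]≡n (<⇒≤ (≰⇒> i≰N)))) ci≡n

enum-map : ∀ {h} → h Preserves _<_ ⟶ _<_ → IsIncreasingEnumeration P c →
  IsIncreasingEnumeration (image h P) (h ∘ c)
enum-map {h = h} h-increasing (increasing , member , surjective) =
  (λ i j 1≤i i<j → h-increasing (increasing i j 1≤i i<j)) ,
  (λ i 1≤i → _ , member i 1≤i , refl) ,
  λ { _ (m , Pm , refl) →
        let (i , 1≤i , ci≡m) = surjective m Pm in i , 1≤i , cong h ci≡m }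

enum-≤-agreeing-below : P ⊆ Q → IsIncreasingEnumeration P c → IsIncreasingEnumeration Q d →
  ∀ {i} → 1 ≤ i → (∀ {j} → j < i → 1 ≤ j → c j ≡ d j) → d i ≤ c i
enum-≤-agreeing-below P⊆Q (increasingP , memberP , _) enumQ@(_ , _ , surjectiveQ)
                      {i} 1≤i agree with surjectiveQ _ (P⊆Q (memberP i 1≤i))
... | k , 1≤k , dk≡ci with i ≤? k
...   | yes i≤k = subst (_ ≤_) dk≡ci (enum-mono enumQ 1≤i i≤k)
...   | no i≰k  =
  contradiction (trans (agree (≰⇒> i≰k) 1≤k) dk≡ci) (<⇒≢ (increasingP k i 1≤k (≰⇒> i≰k)))

enum-unique : P ≐ Q → IsIncreasingEnumeration P c → IsIncreasingEnumeration Q d →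
  ∀ i → 1 ≤ i → c i ≡ d i
enum-unique {c = c} {d = d} (P⊆Q , Q⊆P) enumP enumQ =
  <-rec (λ i → 1 ≤ i → c i ≡ d i) λ i ih 1≤i →
  ≤-antisym (enum-≤-agreeing-below Q⊆P enumQ enumP 1≤i (λ j<i 1≤j → sym (ih j<i 1≤j)))
            (enum-≤-agreeing-below P⊆Q enumP enumQ 1≤i ih)

enum-self-similar : IsIncreasingEnumeration P c → P ⊆ (1 ≤_) →
  ∀ {h} → h Preserves _<_ ⟶ _<_ → ∀ M s → (∀ {i} → 1 ≤ i → i ≤ M + s → c i ≡ i) →
  (P ∩ (M + s <_)) ≐ image h (P ∩ (M <_)) → ∀ i → M + s < i → c i ≡ h (c (i ∸ s))
enum-self-similar {c = c} enum positive {h} h-increasing M s fixed above≐image i M+s<i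
  with m≤n⇒∃[o]m+o≡n M+s<i
... | o , refl = begin
  c (suc (M + s + o))          ≡⟨ cong c (sym (+-suc (M + s) o)) ⟩
  c (M + s + suc o)            ≡⟨ enum-unique above≐image tail scaled-tail (suc o) (s≤s z≤n) ⟩
  h (c (M + suc o))            ≡⟨ cong (h ∘ c) (sym shift) ⟩
  h (c (suc (M + s + o) ∸ s))  ∎
  where
  open ≡-Reasoning
  tail : IsIncreasingEnumeration (_ ∩ (M + s <_)) (λ j → c (M + s + j))
  tail = enum-drop enum positive (M + s) fixed
  scaled-tail : IsIncreasingEnumeration (image h (_ ∩ (M <_))) (λ j → h (c (M + j)))
  scaled-tail = enum-map h-increasing
    (enum-drop enum positive M (λ 1≤i i≤M → fixed 1≤i (≤-trans i≤M (m≤m+n M s))))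
  regroup : ∀ M s o → suc (M + s + o) ≡ M + suc o + s
  regroup = solve-∀
  shift : suc (M + s + o) ∸ s ≡ M + suc o
  shift = trans (cong (_∸ s) (regroup M s o)) (m+n∸n≡m (M + suc o) s)

∤⇒coprime : ∀ {p n} → Prime p → ¬ p ∣ n → Coprime n p
∤⇒coprime pr p∤n (d∣n , d∣p) with prime⇒irreducible pr d∣p
... | inj₁ d≡1  = d≡1
... | inj₂ refl = contradiction d∣n p∤n

prime-power-decomposition : ∀ {p} → Prime p → ∀ n → 1 ≤ n →
  ∃₂ λ b j → 1 ≤ b × b ≤ n × Coprime b p × n ≡ p ^ j * b
prime-power-decomposition {p} pr = <-rec Decomposable decompose
  where
  instance
    p≢0 : NonZero p
    p≢0 = prime⇒nonZero pr

  Decomposable : ℕ → Set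
  Decomposable n = 1 ≤ n → ∃₂ λ b j → 1 ≤ b × b ≤ n × Coprime b p × n ≡ p ^ j * b

  decompose : ∀ n → (∀ {m} → m < n → Decomposable m) → Decomposable n
  decompose n ih 1≤n with p ∣? n
  ... | no p∤n = n , 0 , 1≤n , ≤-refl , ∤⇒coprime pr p∤n , sym (*-identityˡ n)
  decompose .(0 * p) ih () | yes (divides zero refl)
  decompose .(q * p) ih _  | yes (divides q@(suc _) refl)
    with ih (m<m*n q p (nonTrivial⇒n>1 p {{prime⇒nonTrivial pr}})) (s≤s z≤n)
  ... | b , j , 1≤b , b≤q , b⊥p , q≡pʲb =
    b , suc j , 1≤b , ≤-trans b≤q (m≤m*n q p) , b⊥p , q*p≡pʲ⁺¹b
    where
    open ≡-Reasoning
    q*p≡pʲ⁺¹b : q * p ≡ p * p ^ j * b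
    q*p≡pʲ⁺¹b = begin
      q * p            ≡⟨ *-comm q p ⟩
      p * q            ≡⟨ cong (p *_) q≡pʲb ⟩
      p * (p ^ j * b)  ≡⟨ *-assoc p (p ^ j) b ⟨
      p * p ^ j * b    ∎

≤bound⇒F : ∀ {p s n} → Prime p → 1 ≤ n → n ≤ bound p s → F p s n
≤bound⇒F pr 1≤n n≤bound with prime-power-decomposition pr _ 1≤n
... | b , j , 1≤b , b≤n , b⊥p , n≡pʲb =
  b , j , (1≤b , ≤-trans b≤n n≤bound , b⊥p) , n≡pʲb

F⊆positive : ∀ {p s} .{{_ : NonZero p}} → F p s ⊆ (1 ≤_)
F⊆positive {p} (b , j , (1≤b , _) , refl) = *-mono-≤ (m^n>0 p j) 1≤b

F-*ˡ : ∀ {p s m} → F p s m → F p s (p * m)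
F-*ˡ {p} (b , j , Eb , refl) = b , suc j , Eb , sym (*-assoc p (p ^ j) b)

F-above-bound : ∀ {p s M} → p * M ≤ bound p s → bound p s < p * suc M →
  (F p s ∩ (bound p s <_)) ≐ image (p *_) (F p s ∩ (M <_))
F-above-bound {p} {s} {M} p*M≤bound bound<p*[1+M] = divide , multiply
  where
  divide : F p s ∩ (bound p s <_) ⊆ image (p *_) (F p s ∩ (M <_))
  divide ((b , zero , (_ , b≤bound , _) , refl) , bound<b) =
    contradiction b≤bound (<⇒≱ (subst (bound p s <_) (*-identityˡ b) bound<b))
  divide ((b , suc j , Eb , refl) , bound<n) =
    p ^ j * b , ((b , j , Eb , refl) , M<pʲb) , *-assoc p (p ^ j) b
    where
    M<pʲb : M < p ^ j * b
    M<pʲb = *-cancelˡ-< p M _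
      (≤-<-trans p*M≤bound (subst (bound p s <_) (*-assoc p (p ^ j) b) bound<n))

  multiply : image (p *_) (F p s ∩ (M <_)) ⊆ F p s ∩ (bound p s <_)
  multiply (m , (Fm , M<m) , refl) =
    F-*ˡ {s = s} Fm , <-≤-trans bound<p*[1+M] (*-monoʳ-≤ p M<m)

m≤n*⌈m/n⌉ : ∀ m k → m ≤ suc k * ⌈ m / suc k ⌉
m≤n*⌈m/n⌉ m k = +-cancelʳ-≤ k m (suc k * q) (begin
  m + k                        ≡⟨ m≡m%n+[m/n]*n (m + k) (suc k) ⟩
  (m + k) % suc k + q * suc k  ≤⟨ +-monoˡ-≤ (q * suc k) (s≤s⁻¹ (m%n<n (m + k) (suc k))) ⟩
  k + q * suc k                ≡⟨ +-comm k (q * suc k) ⟩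
  q * suc k + k                ≡⟨ cong (_+ k) (*-comm q (suc k)) ⟩
  suc k * q + k                ∎)
  where
  open ≤-Reasoning
  q : ℕ
  q = ⌈ m / suc k ⌉

n*⌈m/n⌉≤m+n∸1 : ∀ m k → suc k * ⌈ m / suc k ⌉ ≤ m + k
n*⌈m/n⌉≤m+n∸1 m k =
  subst (_≤ m + k) (*-comm ⌈ m / suc k ⌉ (suc k)) (m/n*n≤m (m + k) (suc k))

⌈/⌉-pred-bounds : ∀ k s → 1 ≤ s → Σ ℕ λ u →
  ⌈ s / suc k ⌉ ≡ suc u × suc (suc k) * u ≤ u + s × u + s < suc (suc k) * suc u
⌈/⌉-pred-bounds k s 1≤s with ⌈ s / suc k ⌉ | m≤n*⌈m/n⌉ s k | n*⌈m/n⌉≤m+n∸1 s k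
... | zero  | s≤0 | _ =
  contradiction (≤-trans 1≤s (subst (s ≤_) (*-zeroʳ (suc k)) s≤0)) λ ()
... | suc u | s≤[1+k]*[1+u] | [1+k]*[1+u]≤s+k =
  u , refl , +-monoʳ-≤ u (<⇒≤ [1+k]*u<s) , s≤s (+-monoʳ-≤ u s≤[1+k]*[1+u])
  where
  split : suc k * suc u ≡ suc (suc k * u) + k
  split = trans (*-suc (suc k) u) (cong suc (+-comm k (suc k * u)))

  [1+k]*u<s : suc k * u < s
  [1+k]*u<s = +-cancelʳ-≤ k _ s (subst (_≤ s + k) split [1+k]*[1+u]≤s+k)

lemma1p7 : (p s : ℕ) → Prime p → 1 ≤ s → (c : ℕ → ℕ) →
    IsIncreasingEnumeration (F p s) c →
    (∀ i → 1 ≤ i → i ≤ bound p s → c i ≡ i) ×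
    (∀ i → s + ⌈ s / (p ∸ 1) ⌉ ≤ i → c i ≡ p * c (i ∸ s))
lemma1p7 zero       _ pr = contradiction pr λ ()
lemma1p7 (suc zero) _ pr = contradiction pr λ ()
lemma1p7 p@(suc (suc k)) s pr 1≤s c enum with ⌈/⌉-pred-bounds k s 1≤s
... | u , ⌈s/[p∸1]⌉≡1+u , p*u≤u+s , u+s<p*[1+u] = fixed , self-similar
  where
  s+⌈s/[p∸1]⌉≡1+u+s : s + ⌈ s / suc k ⌉ ≡ suc (u + s)
  s+⌈s/[p∸1]⌉≡1+u+s =
    trans (cong (s +_) ⌈s/[p∸1]⌉≡1+u) (trans (+-suc s u) (cong suc (+-comm s u)))

  bound≡u+s : bound p s ≡ u + s
  bound≡u+s = cong (_∸ 1) s+⌈s/[p∸1]⌉≡1+u+s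

  fixed : ∀ i → 1 ≤ i → i ≤ bound p s → c i ≡ i
  fixed _ = enum-fixes-prefix enum (F⊆positive {s = s}) (bound p s) (≤bound⇒F {s = s} pr)

  above≐image : (F p s ∩ (u + s <_)) ≐ image (p *_) (F p s ∩ (u <_))
  above≐image = subst (λ N → (F p s ∩ (N <_)) ≐ image (p *_) (F p s ∩ (u <_))) bound≡u+s
    (F-above-bound {s = s} (subst (p * u ≤_) (sym bound≡u+s) p*u≤u+s)
                           (subst (_< p * suc u) (sym bound≡u+s) u+s<p*[1+u]))

  self-similar : ∀ i → s + ⌈ s / suc k ⌉ ≤ i → c i ≡ p * c (i ∸ s)
  self-similar i s+⌈s/[p∸1]⌉≤i =
    enum-self-similar enum (F⊆positive {s = s}) (*-monoʳ-< p) u s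
    (λ {j} 1≤j j≤u+s → fixed j 1≤j (subst (j ≤_) (sym bound≡u+s) j≤u+s)) above≐image i
    (subst (_≤ i) s+⌈s/[p∸1]⌉≡1+u+s s+⌈s/[p∸1]⌉≤i)
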